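{- Every $B$-term is $\beta\eta$-equivalent to a $\lambda$-term of the form $\lambda x_1.\cdots\lambda x_k.\,M$ for some $k>2$, where $M$ satisfies: (1) $M$ is built only from the variables $x_1,\dots,x_k$ by application; and (2) for every subterm of $M$ of the form $M_1\,M_2$, if $M_1$ contains a variable $x_i$, then $M_2$ contains no variable $x_j$ with $j\le i$.
   Context: $B=\lambda f.\lambda g.\lambda x.\, f\,(g\,x)$. A $B$-term is a combinatory term built from $B$ alone by application, identified with the $\lambda$-term obtained by replacing each $B$ by $\lambda f.\lambda g.\lambda x.\, f\,(g\,x)$. -}

module Defs where

open import Data.Nat using (ℕ; zero; suc)
open import Data.Fin using (Fin; zero; suc; opposite) renaming (_<_ to _<ꟳ_)
open import Data.Product using (_×_)
open import Data.Sum using (_⊎_)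
open import Relation.Binary.PropositionalEquality using (_≡_)
open import Relation.Binary.Construct.Closure.Equivalence using (EqClosure)

data Tm (n : ℕ) : Set where
  var : Fin n → Tm n
  app : Tm n → Tm n → Tm n
  lam : Tm (suc n) → Tm n

ext : ∀ {m n} → (Fin m → Fin n) → Fin (suc m) → Fin (suc n)
ext ρ zero    = zero
ext ρ (suc i) = suc (ρ i)

rename : ∀ {m n} → (Fin m → Fin n) → Tm m → Tm n
rename ρ (var i)   = var (ρ i)
rename ρ (app t u) = app (rename ρ t) (rename ρ u)
rename ρ (lam t)   = lam (rename (ext ρ) t)

exts : ∀ {m n} → (Fin m → Tm n) → Fin (suc m) → Tm (suc n)
exts σ zero    = var zero
exts σ (suc i) = rename suc (σ i)

subst : ∀ {m n} → (Fin m → Tm n) → Tm m → Tm n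
subst σ (var i)   = σ i
subst σ (app t u) = app (subst σ t) (subst σ u)
subst σ (lam t)   = lam (subst (exts σ) t)

single : ∀ {n} → Tm n → Fin (suc n) → Tm n
single u zero    = u
single u (suc i) = var i

_[_] : ∀ {n} → Tm (suc n) → Tm n → Tm n
t [ u ] = subst (single u) t

data _⟶_ {n : ℕ} : Tm n → Tm n → Set where
  β    : ∀ {t : Tm (suc n)} {u} → app (lam t) u ⟶ (t [ u ])
  η    : ∀ {t : Tm n} → lam (app (rename suc t) (var zero)) ⟶ t
  appˡ : ∀ {t t′ u} → t ⟶ t′ → app t u ⟶ app t′ u
  appʳ : ∀ {t u u′} → u ⟶ u′ → app t u ⟶ app t u′
  ξ    : ∀ {t t′ : Tm (suc n)} → t ⟶ t′ → lam t ⟶ lam t′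

_≡βη_ : ∀ {n} → Tm n → Tm n → Set
_≡βη_ = EqClosure _⟶_

data BTm : Set where
  B   : BTm
  _·_ : BTm → BTm → BTm

-- B = λf.λg.λx. f (g x)
Bλ : Tm 0
Bλ = lam (lam (lam (app (var (suc (suc zero))) (app (var (suc zero)) (var zero)))))

⟦_⟧ : BTm → Tm 0
⟦ B ⟧     = Bλ
⟦ s · t ⟧ = app ⟦ s ⟧ ⟦ t ⟧

-- Applicative terms over variables x₁ … x_k (x_{i+1} represented by i : Fin k)

data App (k : ℕ) : Set where
  v   : Fin k → App k
  _∙_ : App k → App k → App k

data Occ {k : ℕ} (i : Fin k) : App k → Set where
  here : Occ i (v i)
  left : ∀ {M N} → Occ i M → Occ i (M ∙ N)
  right : ∀ {M N} → Occ i N → Occ i (M ∙ N)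

-- condition (2): for every subterm M₁ M₂, if x_i occurs in M₁ and x_j
-- occurs in M₂ then i < j (i.e. not j ≤ i)
Ordered : ∀ {k} → App k → Set
Ordered (v i)   = Data.Unit.⊤ where import Data.Unit
Ordered (M ∙ N) = Ordered M × Ordered N × (∀ i j → Occ i M → Occ j N → i <ꟳ j)

-- embedding under k binders λx₁…λx_k: x_{i+1} is de Bruijn index k-1-i
embed : ∀ {k} → App k → Tm k
embed (v i)   = var (opposite i)
embed (M ∙ N) = app (embed M) (embed N)

lams : ∀ k → Tm k → Tm 0
lams zero    t = t
lams (suc k) t = lams k (lam t)

-- A spine tree T (a rose tree) describes an applicative term: each node takes the next
-- argument, in preorder, as its head and applies it to its children. Every B-term t has such
-- a shape: for k = size T, t x₁ … x_k reduces to T filled with x₁, …, x_k (further arguments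
-- are applied to the result). B has shape x₁ (x₂ x₃). If s has shape node F, then s t x⃗
-- reduces to t applied to the subtrees F filled with x⃗, so the shape of s t is that of t
-- with the subtrees F grafted onto its first nodes. As the arguments fill the nodes in
-- preorder, the leaves of the filled tree read x₁, …, x_k from left to right, which is
-- condition (2); η-expanding k times gives t =βη λx₁…λx_k. T[x₁, …, x_k].

module Submission where

open import Defs
open import Data.Nat using (ℕ; zero; suc; _+_; _∸_; _≤_; _<_; z≤n; s≤s)
open import Data.Nat.Properties
  using ( ≤-trans; ≤-reflexive; +-assoc; +-comm; +-identityʳ; +-monoˡ-≤; +-monoʳ-≤; ∸-+-assoc; 0∸n≡0
        ; m≤n+m; m≤n+m∸n; m+n≤o⇒m≤o; m+n≤o⇒m≤o∸n; module ≤-Reasoning)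
open import Data.Fin using (Fin; zero; suc; opposite; fromℕ; inject₁) renaming (_<_ to _<ꟳ_)
open import Data.List using (List; []; _∷_; _++_; _∷ʳ_; map; foldl; concat; length; tabulate; allFin)
open import Data.List.Properties
  using ( foldl-++; foldl-∷ʳ; ++-assoc; ++-identityʳ; length-++; length-map; length-tabulate
        ; map-tabulate; tabulate-cong; map-∘; concat-map-[_])
open import Data.List.Membership.Propositional using (_∈_)
open import Data.List.Membership.Propositional.Properties using (∈-++⁺ˡ; ∈-++⁺ʳ)
open import Data.List.Relation.Unary.All as All using (All; []; _∷_)
open import Data.List.Relation.Unary.All.Properties using (++⁻ˡ; ++⁻ʳ)
open import Data.List.Relation.Unary.AllPairs using (AllPairs; []; _∷_)
open import Data.List.Relation.Unary.AllPairs.Properties using (tabulate⁺-<)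
open import Data.List.Relation.Unary.Any as Any using ()
open import Data.Product
  using (Σ; _×_; _,_; proj₁; proj₂; map₁; map₂; uncurry) renaming (map to map×)
open import Data.Unit using (tt)
open import Function using (_∘_; id)
open import Relation.Binary.Construct.Closure.Equivalence as EqClosure using ()
open import Relation.Binary.Construct.Closure.ReflexiveTransitive using (ε; _◅_)
open import Relation.Binary.Construct.Closure.Symmetric using (fwd; bwd)
open import Relation.Binary.PropositionalEquality as ≡
  using (_≡_; refl; sym; trans; cong; cong₂; module ≡-Reasoning)
import Relation.Binary.Reasoning.Setoid as SetoidReasoning

exts-cong : ∀ {m n} {σ τ : Fin m → Tm n} → (∀ i → σ i ≡ τ i) →
            ∀ i → exts σ i ≡ exts τ i
exts-cong σ≗τ zero    = refl
exts-cong σ≗τ (suc i) = cong (rename suc) (σ≗τ i)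

subst-cong : ∀ {m n} {σ τ : Fin m → Tm n} → (∀ i → σ i ≡ τ i) →
             ∀ t → subst σ t ≡ subst τ t
subst-cong σ≗τ (var i)   = σ≗τ i
subst-cong σ≗τ (app t u) = cong₂ app (subst-cong σ≗τ t) (subst-cong σ≗τ u)
subst-cong σ≗τ (lam t)   = cong lam (subst-cong (exts-cong σ≗τ) t)

subst-rename : ∀ {l m n} (σ : Fin m → Tm n) (ρ : Fin l → Fin m) t →
               subst σ (rename ρ t) ≡ subst (σ ∘ ρ) t
subst-rename σ ρ (var i)   = refl
subst-rename σ ρ (app t u) = cong₂ app (subst-rename σ ρ t) (subst-rename σ ρ u)
subst-rename σ ρ (lam t)   =
  cong lam (trans (subst-rename (exts σ) (ext ρ) t) (subst-cong (λ { zero → refl ; (suc i) → refl }) t))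

subst-var : ∀ {m n} (ρ : Fin m → Fin n) t → subst (var ∘ ρ) t ≡ rename ρ t
subst-var ρ (var i)   = refl
subst-var ρ (app t u) = cong₂ app (subst-var ρ t) (subst-var ρ u)
subst-var ρ (lam t)   =
  cong lam (trans (subst-cong (λ { zero → refl ; (suc i) → refl }) t) (subst-var (ext ρ) t))

subst-id : ∀ {n} (t : Tm n) → subst var t ≡ t
subst-id (var i)   = refl
subst-id (app t u) = cong₂ app (subst-id t) (subst-id u)
subst-id (lam t)   = cong lam (trans (subst-cong (λ { zero → refl ; (suc i) → refl }) t) (subst-id t))

subst-single-rename : ∀ {n} (u : Tm n) t → subst (single u) (rename suc t) ≡ t
subst-single-rename u t = trans (subst-rename (single u) suc t) (subst-id t)

module ≡βη-Reasoning {n : ℕ} = SetoidReasoning (EqClosure.setoid (_⟶_ {n}))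

≡⇒≡βη : ∀ {n} {t u : Tm n} → t ≡ u → t ≡βη u
≡⇒≡βη refl = ε

app-congˡ : ∀ {n} {t t′ : Tm n} u → t ≡βη t′ → app t u ≡βη app t′ u
app-congˡ u = EqClosure.gmap (λ t → app t u) appˡ

foldl-app-congˡ : ∀ {n} {t t′ : Tm n} us → t ≡βη t′ → foldl app t us ≡βη foldl app t′ us
foldl-app-congˡ []       t≡t′ = t≡t′
foldl-app-congˡ (u ∷ us) t≡t′ = foldl-app-congˡ us (app-congˡ u t≡t′)

lams-cong : ∀ k {t t′ : Tm k} → t ≡βη t′ → lams k t ≡βη lams k t′
lams-cong zero    t≡t′ = t≡t′
lams-cong (suc k) t≡t′ = lams-cong k (EqClosure.gmap lam ξ t≡t′)

rename-foldl-app : ∀ {m n} (ρ : Fin m → Fin n) t us →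
                   rename ρ (foldl app t us) ≡ foldl app (rename ρ t) (map (rename ρ) us)
rename-foldl-app ρ t []       = refl
rename-foldl-app ρ t (u ∷ us) = rename-foldl-app ρ (app t u) us

⟦_⟧ⁿ : ∀ {n} → BTm → Tm n
⟦ B ⟧ⁿ     = lam (lam (lam (app (var (suc (suc zero))) (app (var (suc zero)) (var zero)))))
⟦ s · t ⟧ⁿ = app ⟦ s ⟧ⁿ ⟦ t ⟧ⁿ

⟦⟧ⁿ-closed : ∀ t → ⟦ t ⟧ⁿ ≡ ⟦ t ⟧
⟦⟧ⁿ-closed B       = refl
⟦⟧ⁿ-closed (s · t) = cong₂ app (⟦⟧ⁿ-closed s) (⟦⟧ⁿ-closed t)

rename-⟦⟧ⁿ : ∀ {m n} (ρ : Fin m → Fin n) t → rename ρ ⟦ t ⟧ⁿ ≡ ⟦ t ⟧ⁿ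
rename-⟦⟧ⁿ ρ B       = refl
rename-⟦⟧ⁿ ρ (s · t) = cong₂ app (rename-⟦⟧ⁿ ρ s) (rename-⟦⟧ⁿ ρ t)

B-β : ∀ {n} (a b c : Tm n) → app (app (app ⟦ B ⟧ⁿ a) b) c ≡βη app a (app b c)
B-β a b c = fwd (appˡ (appˡ β)) ◅ fwd (appˡ β) ◅ fwd β ◅
  ≡⇒≡βη (cong₂ (λ a′ b′ → app a′ (app b′ c)) a-restored (subst-single-rename c b))
  where
  open ≡-Reasoning
  a-restored : subst (single c) (subst (exts (single b)) (rename suc (rename suc a))) ≡ a
  a-restored = begin
    subst (single c) (subst (exts (single b)) (rename suc (rename suc a)))
      ≡⟨ cong (subst (single c)) (subst-rename (exts (single b)) suc (rename suc a)) ⟩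
    subst (single c) (subst (rename suc ∘ single b) (rename suc a))
      ≡⟨ cong (subst (single c)) (trans (subst-rename _ suc a) (subst-var suc a)) ⟩
    subst (single c) (rename suc a)
      ≡⟨ subst-single-rename c a ⟩
    a ∎

data Tree : Set where
  node : List Tree → Tree

leaf : Tree
leaf = node []

mutual
  size : Tree → ℕ
  size (node F) = suc (sizes F)

  sizes : List Tree → ℕ
  sizes []      = 0
  sizes (T ∷ F) = size T + sizes F

_⊲_ : Tree → Tree → Tree
node F ⊲ T = node (F ∷ʳ T)

-- When the inputs run out, the default d is used: a junk value everywhere except in
-- grafting, where it pads the forest with leaves.
module Eval {X : Set} (_·_ : X → X → X) (d : X) where

  next : List X → X × List X
  next []       = d , []
  next (x ∷ xs) = x , xs

  mutual
    eval : Tree → List X → X × List X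
    eval (node F) xs = let (x , ys) = next xs in map₁ (foldl _·_ x) (evals F ys)

    evals : List Tree → List X → List X × List X
    evals []      xs = [] , xs
    evals (T ∷ F) xs = let (y , ys) = eval T xs in map₁ (y ∷_) (evals F ys)

  run : Tree → List X → X
  run T xs = uncurry (foldl _·_) (eval T xs)

  runs : List Tree → List X → List X
  runs F xs = uncurry _++_ (evals F xs)

-- In the magma of trees under _⊲_, evaluating T on a forest R grafts: the i-th node of T in
-- preorder becomes the i-th tree of R with T's children appended, and the unused trees of R
-- are returned.
module Graft = Eval _⊲_ leaf

_⊛_ : Tree → Tree → Tree
node F ⊛ T = Graft.run T F

m+n≤o⇒n≤o∸m : ∀ m {n o} → m + n ≤ o → n ≤ o ∸ m
m+n≤o⇒n≤o∸m m {n} le = m+n≤o⇒m≤o∸n n (≤-trans (≤-reflexive (+-comm n m)) le)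

[m∸o]+[n∸[o∸m]]≡m+n∸o : ∀ m n o → (m ∸ o) + (n ∸ (o ∸ m)) ≡ m + n ∸ o
[m∸o]+[n∸[o∸m]]≡m+n∸o zero    n zero    = refl
[m∸o]+[n∸[o∸m]]≡m+n∸o zero    n (suc o) = refl
[m∸o]+[n∸[o∸m]]≡m+n∸o (suc m) n zero    = refl
[m∸o]+[n∸[o∸m]]≡m+n∸o (suc m) n (suc o) = [m∸o]+[n∸[o∸m]]≡m+n∸o m n o

module EvalProperties {X : Set} (_·_ : X → X → X) (d : X) where

  open Eval _·_ d public

  run-node : ∀ F x xs → run (node F) (x ∷ xs) ≡ foldl _·_ x (runs F xs)
  run-node F x xs = sym (foldl-++ _·_ x (proj₁ (evals F xs)) (proj₂ (evals F xs)))

  evals-++ : ∀ F G xs → evals (F ++ G) xs ≡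
             (let (as , ys) = evals F xs in map₁ (as ++_) (evals G ys))
  evals-++ []      G xs = refl
  evals-++ (T ∷ F) G xs = cong (map₁ (proj₁ (eval T xs) ∷_)) (evals-++ F G (proj₂ (eval T xs)))

  eval-⊲ : ∀ T U xs → eval (T ⊲ U) xs ≡
           (let (a , ys) = eval T xs in map₁ (a ·_) (eval U ys))
  eval-⊲ (node F) U xs =
    trans (cong (map₁ (foldl _·_ x)) (evals-++ F (U ∷ []) ys))
          (cong (_, proj₂ (eval U zs)) (foldl-∷ʳ _·_ x (proj₁ (eval U zs)) as))
    where
    x : X
    x = proj₁ (next xs)
    ys as zs : List X
    ys = proj₂ (next xs)
    as = proj₁ (evals F ys)
    zs = proj₂ (evals F ys)

  eval-foldl-⊲ : ∀ T G xs → eval (foldl _⊲_ T G) xs ≡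
                 (let (a , ys) = eval T xs in map₁ (foldl _·_ a) (evals G ys))
  eval-foldl-⊲ T []      xs = refl
  eval-foldl-⊲ T (U ∷ G) xs =
    trans (eval-foldl-⊲ (T ⊲ U) G xs)
          (cong (λ p → map₁ (foldl _·_ (proj₁ p)) (evals G (proj₂ p))) (eval-⊲ T U xs))

  length-evals₁ : ∀ F xs → length (proj₁ (evals F xs)) ≡ length F
  length-evals₁ []      xs = refl
  length-evals₁ (T ∷ F) xs = cong suc (length-evals₁ F _)

  mutual
    length-eval₂ : ∀ T xs → length (proj₂ (eval T xs)) ≡ length xs ∸ size T
    length-eval₂ (node F) []       = trans (length-evals₂ F []) (0∸n≡0 (sizes F))
    length-eval₂ (node F) (x ∷ xs) = length-evals₂ F xs

    length-evals₂ : ∀ F xs → length (proj₂ (evals F xs)) ≡ length xs ∸ sizes F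
    length-evals₂ []      xs = refl
    length-evals₂ (T ∷ F) xs =
      trans (length-evals₂ F _)
            (trans (cong (_∸ sizes F) (length-eval₂ T xs)) (∸-+-assoc (length xs) (size T) (sizes F)))

  length-runs : ∀ F xs → length (runs F xs) ≡ length F + (length xs ∸ sizes F)
  length-runs F xs =
    trans (length-++ (proj₁ (evals F xs))) (cong₂ _+_ (length-evals₁ F xs) (length-evals₂ F xs))

  size≤length-runs : ∀ F T xs → sizes F + (size T ∸ length F) ≤ length xs →
                     size T ≤ length (runs F xs)
  size≤length-runs F T xs bound = begin
      size T                            ≤⟨ m≤n+m∸n (size T) (length F) ⟩
      length F + (size T ∸ length F)    ≤⟨ +-monoʳ-≤ (length F) (m+n≤o⇒n≤o∸m (sizes F) bound) ⟩
      length F + (length xs ∸ sizes F)  ≡⟨ length-runs F xs ⟨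
      length (runs F xs)                ∎
    where open ≤-Reasoning

  next-runs : ∀ R xs → next (runs R xs) ≡ (let (r , R′) = Graft.next R in map₂ (runs R′) (eval r xs))
  next-runs []      xs = refl
  next-runs (r ∷ R) xs = refl

  mutual
    eval-graft : ∀ T R xs →
      (let (U , R′) = Graft.eval T R in map₂ (runs R′) (eval U xs)) ≡ eval T (runs R xs)
    eval-graft (node F) R xs = begin
        map₂ (runs R′) (eval (foldl _⊲_ r Us) xs)
      ≡⟨ cong (map₂ (runs R′)) (eval-foldl-⊲ r Us xs) ⟩
        map₁ (foldl _·_ a) (map₂ (runs R′) (evals Us ys))
      ≡⟨ cong (map₁ (foldl _·_ a)) (evals-graft F R₀ ys) ⟩
        map₁ (foldl _·_ a) (evals F (runs R₀ ys))
      ≡⟨ cong (λ p → map₁ (foldl _·_ (proj₁ p)) (evals F (proj₂ p))) (next-runs R xs) ⟨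
        eval (node F) (runs R xs)
      ∎
      where
      open ≡-Reasoning
      r : Tree
      r = proj₁ (Graft.next R)
      R₀ Us R′ : List Tree
      R₀ = proj₂ (Graft.next R)
      Us = proj₁ (Graft.evals F R₀)
      R′ = proj₂ (Graft.evals F R₀)
      a : X
      a = proj₁ (eval r xs)
      ys : List X
      ys = proj₂ (eval r xs)

    evals-graft : ∀ F R xs →
      (let (Us , R′) = Graft.evals F R in map₂ (runs R′) (evals Us xs)) ≡ evals F (runs R xs)
    evals-graft []      R xs = refl
    evals-graft (T ∷ F) R xs =
      trans (cong (map₁ (a ∷_)) (evals-graft F R₁ ys))
            (cong (λ p → map₁ (proj₁ p ∷_) (evals F (proj₂ p))) (eval-graft T R xs))
      where
      R₁ : List Tree
      R₁ = proj₂ (Graft.eval T R)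
      a : X
      a = proj₁ (eval (proj₁ (Graft.eval T R)) xs)
      ys : List X
      ys = proj₂ (eval (proj₁ (Graft.eval T R)) xs)

  run-⊛ : ∀ F T xs → run (node F ⊛ T) xs ≡ run T (runs F xs)
  run-⊛ F T xs = begin
      uncurry (foldl _·_) (eval (foldl _⊲_ U R′) xs)
    ≡⟨ cong (uncurry (foldl _·_)) (eval-foldl-⊲ U R′ xs) ⟩
      foldl _·_ (foldl _·_ a (proj₁ (evals R′ ys))) (proj₂ (evals R′ ys))
    ≡⟨ foldl-++ _·_ a (proj₁ (evals R′ ys)) (proj₂ (evals R′ ys)) ⟨
      uncurry (foldl _·_) (map₂ (runs R′) (eval U xs))
    ≡⟨ cong (uncurry (foldl _·_)) (eval-graft T F xs) ⟩
      run T (runs F xs)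
    ∎
    where
    open ≡-Reasoning
    U : Tree
    U = proj₁ (Graft.eval T F)
    R′ : List Tree
    R′ = proj₂ (Graft.eval T F)
    a : X
    a = proj₁ (eval U xs)
    ys : List X
    ys = proj₂ (eval U xs)

sizes-++ : ∀ F G → sizes (F ++ G) ≡ sizes F + sizes G
sizes-++ []      G = refl
sizes-++ (T ∷ F) G = trans (cong (size T +_) (sizes-++ F G)) (sym (+-assoc (size T) (sizes F) (sizes G)))

size-foldl-⊲ : ∀ T G → size (foldl _⊲_ T G) ≡ size T + sizes G
size-foldl-⊲ T       []      = sym (+-identityʳ (size T))
size-foldl-⊲ (node F) (U ∷ G) = begin
    size (foldl _⊲_ (node (F ∷ʳ U)) G)
  ≡⟨ size-foldl-⊲ (node (F ∷ʳ U)) G ⟩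
    suc (sizes (F ∷ʳ U)) + sizes G
  ≡⟨ cong (λ n → suc n + sizes G)
          (trans (sizes-++ F (U ∷ [])) (cong (sizes F +_) (+-identityʳ (size U)))) ⟩
    suc (sizes F + size U) + sizes G
  ≡⟨ cong suc (+-assoc (sizes F) (size U) (sizes G)) ⟩
    suc (sizes F + (size U + sizes G))
  ∎
  where open ≡-Reasoning

mutual
  size-graft : ∀ T R →
    (let (U , R′) = Graft.eval T R in size U + sizes R′) ≡ sizes R + (size T ∸ length R)
  size-graft (node F) [] = begin
      size (foldl _⊲_ leaf Us) + sizes R′  ≡⟨ cong (_+ sizes R′) (size-foldl-⊲ leaf Us) ⟩
      suc (sizes Us) + sizes R′             ≡⟨ cong suc (sizes-graft F []) ⟩
      suc (sizes F)                         ∎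
    where
    open ≡-Reasoning
    Us R′ : List Tree
    Us = proj₁ (Graft.evals F [])
    R′ = proj₂ (Graft.evals F [])
  size-graft (node F) (r ∷ R) = begin
      size (foldl _⊲_ r Us) + sizes R′         ≡⟨ cong (_+ sizes R′) (size-foldl-⊲ r Us) ⟩
      size r + sizes Us + sizes R′             ≡⟨ +-assoc (size r) (sizes Us) (sizes R′) ⟩
      size r + (sizes Us + sizes R′)           ≡⟨ cong (size r +_) (sizes-graft F R) ⟩
      size r + (sizes R + (sizes F ∸ length R)) ≡⟨ +-assoc (size r) (sizes R) _ ⟨
      size r + sizes R + (sizes F ∸ length R)  ∎
    where
    open ≡-Reasoning
    Us R′ : List Tree
    Us = proj₁ (Graft.evals F R)
    R′ = proj₂ (Graft.evals F R)

  sizes-graft : ∀ F R →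
    (let (Us , R′) = Graft.evals F R in sizes Us + sizes R′) ≡ sizes R + (sizes F ∸ length R)
  sizes-graft []      R = sym (trans (cong (sizes R +_) (0∸n≡0 (length R))) (+-identityʳ (sizes R)))
  sizes-graft (T ∷ F) R = begin
      size U + sizes Us + sizes R′
    ≡⟨ +-assoc (size U) (sizes Us) (sizes R′) ⟩
      size U + (sizes Us + sizes R′)
    ≡⟨ cong (size U +_) (sizes-graft F R₁) ⟩
      size U + (sizes R₁ + (sizes F ∸ length R₁))
    ≡⟨ +-assoc (size U) (sizes R₁) _ ⟨
      size U + sizes R₁ + (sizes F ∸ length R₁)
    ≡⟨ cong₂ _+_ (size-graft T R) (cong (sizes F ∸_) (length-eval₂ T R)) ⟩
      sizes R + (size T ∸ length R) + (sizes F ∸ (length R ∸ size T))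
    ≡⟨ +-assoc (sizes R) _ _ ⟩
      sizes R + ((size T ∸ length R) + (sizes F ∸ (length R ∸ size T)))
    ≡⟨ cong (sizes R +_) ([m∸o]+[n∸[o∸m]]≡m+n∸o (size T) (sizes F) (length R)) ⟩
      sizes R + (size T + sizes F ∸ length R)
    ∎
    where
    open ≡-Reasoning
    open EvalProperties _⊲_ leaf using (length-eval₂)
    U : Tree
    U = proj₁ (Graft.eval T R)
    R₁ Us R′ : List Tree
    R₁ = proj₂ (Graft.eval T R)
    Us = proj₁ (Graft.evals F R₁)
    R′ = proj₂ (Graft.evals F R₁)

size-⊛ : ∀ F T → size (node F ⊛ T) ≡ sizes F + (size T ∸ length F)
size-⊛ F T = trans (size-foldl-⊲ (proj₁ (Graft.eval T F)) (proj₂ (Graft.eval T F))) (size-graft T F)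

module _ {X Y : Set} {_·_ : X → X → X} {_∗_ : Y → Y → Y} {d : X} {e : Y}
         (f : X → Y) (f-· : ∀ a b → f (a · b) ≡ f a ∗ f b) (f-d : f d ≡ e) where

  private
    module EX = Eval _·_ d
    module EY = Eval _∗_ e

  foldl-hom : ∀ x as → f (foldl _·_ x as) ≡ foldl _∗_ (f x) (map f as)
  foldl-hom x []       = refl
  foldl-hom x (a ∷ as) = trans (foldl-hom (x · a) as) (cong (λ y → foldl _∗_ y (map f as)) (f-· x a))

  next-hom : ∀ xs → map× f (map f) (EX.next xs) ≡ EY.next (map f xs)
  next-hom []       = cong (_, []) f-d
  next-hom (x ∷ xs) = refl

  mutual
    eval-hom : ∀ T xs → map× f (map f) (EX.eval T xs) ≡ EY.eval T (map f xs)
    eval-hom (node F) xs = begin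
        map× f (map f) (map₁ (foldl _·_ x) (EX.evals F ys))
      ≡⟨ cong (_, map f (proj₂ (EX.evals F ys))) (foldl-hom x (proj₁ (EX.evals F ys))) ⟩
        map₁ (foldl _∗_ (f x)) (map× (map f) (map f) (EX.evals F ys))
      ≡⟨ cong (map₁ (foldl _∗_ (f x))) (evals-hom F ys) ⟩
        map₁ (foldl _∗_ (f x)) (EY.evals F (map f ys))
      ≡⟨ cong (λ p → map₁ (foldl _∗_ (proj₁ p)) (EY.evals F (proj₂ p))) (next-hom xs) ⟩
        EY.eval (node F) (map f xs)
      ∎
      where
      open ≡-Reasoning
      x : X
      x = proj₁ (EX.next xs)
      ys : List X
      ys = proj₂ (EX.next xs)

    evals-hom : ∀ F xs → map× (map f) (map f) (EX.evals F xs) ≡ EY.evals F (map f xs)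
    evals-hom []      xs = refl
    evals-hom (T ∷ F) xs =
      trans (cong (map₁ (f (proj₁ (EX.eval T xs)) ∷_)) (evals-hom F (proj₂ (EX.eval T xs))))
            (cong (λ p → map₁ (proj₁ p ∷_) (EY.evals F (proj₂ p))) (eval-hom T xs))

  run-hom : ∀ T xs → f (EX.run T xs) ≡ EY.run T (map f xs)
  run-hom T xs = trans (foldl-hom (proj₁ (EX.eval T xs)) (proj₂ (EX.eval T xs)))
                       (cong (uncurry (foldl _∗_)) (eval-hom T xs))

module _ {A : Set} (d : List A) where

  open EvalProperties (_++_ {A = A}) d

  foldl-++-concat : ∀ (x : List A) xss → foldl _++_ x xss ≡ x ++ concat xss
  foldl-++-concat x []         = sym (++-identityʳ x)
  foldl-++-concat x (xs ∷ xss) = trans (foldl-++-concat (x ++ xs) xss) (++-assoc x xs (concat xss))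

  mutual
    eval-concat : ∀ T xss → size T ≤ length xss →
                  proj₁ (eval T xss) ++ concat (proj₂ (eval T xss)) ≡ concat xss
    eval-concat (node F) (x ∷ xss) (s≤s F≤xss) = begin
        foldl _++_ x as ++ concat rest   ≡⟨ cong (_++ concat rest) (foldl-++-concat x as) ⟩
        (x ++ concat as) ++ concat rest  ≡⟨ ++-assoc x (concat as) (concat rest) ⟩
        x ++ (concat as ++ concat rest)  ≡⟨ cong (x ++_) (evals-concat F xss F≤xss) ⟩
        x ++ concat xss                  ∎
      where
      open ≡-Reasoning
      as rest : List (List A)
      as = proj₁ (evals F xss)
      rest = proj₂ (evals F xss)

    evals-concat : ∀ F xss → sizes F ≤ length xss →
                   concat (proj₁ (evals F xss)) ++ concat (proj₂ (evals F xss)) ≡ concat xss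
    evals-concat []      xss _     = refl
    evals-concat (T ∷ F) xss TF≤xss = begin
        (a ++ concat as) ++ concat rest  ≡⟨ ++-assoc a (concat as) (concat rest) ⟩
        a ++ (concat as ++ concat rest)  ≡⟨ cong (a ++_) (evals-concat F yss F≤yss) ⟩
        a ++ concat yss                  ≡⟨ eval-concat T xss (m+n≤o⇒m≤o (size T) TF≤xss) ⟩
        concat xss                       ∎
      where
      open ≡-Reasoning
      a : List A
      a = proj₁ (eval T xss)
      yss as rest : List (List A)
      yss = proj₂ (eval T xss)
      as = proj₁ (evals F yss)
      rest = proj₂ (evals F yss)
      F≤yss : sizes F ≤ length yss
      F≤yss = ≤-trans (m+n≤o⇒n≤o∸m (size T) TF≤xss) (≤-reflexive (sym (length-eval₂ T xss)))

  run-concat : ∀ T xss → size T ≤ length xss → run T xss ≡ concat xss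
  run-concat T xss T≤xss =
    trans (foldl-++-concat (proj₁ (eval T xss)) (proj₂ (eval T xss))) (eval-concat T xss T≤xss)

leaves : ∀ {k} → App k → List (Fin k)
leaves (v i)   = i ∷ []
leaves (M ∙ N) = leaves M ++ leaves N

Occ⇒∈leaves : ∀ {k} {i : Fin k} {M} → Occ i M → i ∈ leaves M
Occ⇒∈leaves here                  = Any.here refl
Occ⇒∈leaves (left o)              = ∈-++⁺ˡ (Occ⇒∈leaves o)
Occ⇒∈leaves {M = M ∙ _} (right o) = ∈-++⁺ʳ (leaves M) (Occ⇒∈leaves o)

AllPairs-++⁻ : ∀ {A : Set} {R : A → A → Set} xs {ys} → AllPairs R (xs ++ ys) →
               AllPairs R xs × AllPairs R ys × All (λ x → All (R x) ys) xs
AllPairs-++⁻ []       Rys            = [] , Rys , []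
AllPairs-++⁻ (x ∷ xs) (Rx ∷ Rxs++ys) =
  let (Rxs , Rys , Rxsys) = AllPairs-++⁻ xs Rxs++ys
  in (++⁻ˡ xs Rx ∷ Rxs) , Rys , (++⁻ʳ xs Rx ∷ Rxsys)

sortedLeaves⇒Ordered : ∀ {k} (M : App k) → AllPairs _<ꟳ_ (leaves M) → Ordered M
sortedLeaves⇒Ordered (v i)   _ = tt
sortedLeaves⇒Ordered (M ∙ N) sorted =
  let (sM , sN , sMN) = AllPairs-++⁻ (leaves M) sorted
  in sortedLeaves⇒Ordered M sM , sortedLeaves⇒Ordered N sN ,
     λ i j i∈M j∈N → All.lookup (All.lookup sMN (Occ⇒∈leaves i∈M)) (Occ⇒∈leaves j∈N)

shape : BTm → Tree
shape B       = node (node (leaf ∷ []) ∷ [])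
shape (s · t) = shape s ⊛ shape t

HasShape : (∀ {n} → Tm n) → Tree → Set
HasShape S T = ∀ {n} (d : Tm n) xs → size T ≤ length xs → foldl app S xs ≡βη Eval.run app d T xs

HasShape-⊛ : ∀ {S T : ∀ {n} → Tm n} Tₛ Tₜ → HasShape S Tₛ → HasShape T Tₜ →
             HasShape (app S T) (Tₛ ⊛ Tₜ)
HasShape-⊛ {S} {T} (node F) Tₜ hasShape-S hasShape-T d xs ⊛≤xs = begin
    foldl app S (T ∷ xs)     ≈⟨ hasShape-S d (T ∷ xs) (s≤s (m+n≤o⇒m≤o (sizes F) bound)) ⟩
    run (node F) (T ∷ xs)    ≡⟨ run-node F T xs ⟩
    foldl app T (runs F xs)  ≈⟨ hasShape-T d (runs F xs) (size≤length-runs F Tₜ xs bound) ⟩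
    run Tₜ (runs F xs)       ≡⟨ run-⊛ F Tₜ xs ⟨
    run (node F ⊛ Tₜ) xs     ∎
  where
  open EvalProperties app d
  open ≡βη-Reasoning
  bound : sizes F + (size Tₜ ∸ length F) ≤ length xs
  bound = ≤-trans (≤-reflexive (sym (size-⊛ F Tₜ))) ⊛≤xs

hasShape : ∀ t → HasShape ⟦ t ⟧ⁿ (shape t)
hasShape B       d (a ∷ b ∷ c ∷ xs) (s≤s (s≤s (s≤s _))) = foldl-app-congˡ xs (B-β a b c)
hasShape (s · t) = HasShape-⊛ (shape s) (shape t) (hasShape s) (hasShape t)

length≤sizes : ∀ F → length F ≤ sizes F
length≤sizes []           = z≤n
length≤sizes (node G ∷ F) = s≤s (≤-trans (length≤sizes F) (m≤n+m (sizes F) (sizes G)))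

size≤size-⊛ : ∀ Tₛ T → size T ≤ size (Tₛ ⊛ T)
size≤size-⊛ (node F) T = begin
    size T                            ≤⟨ m≤n+m∸n (size T) (length F) ⟩
    length F + (size T ∸ length F)    ≤⟨ +-monoˡ-≤ (size T ∸ length F) (length≤sizes F) ⟩
    sizes F + (size T ∸ length F)     ≡⟨ size-⊛ F T ⟨
    size (node F ⊛ T)                 ∎
  where open ≤-Reasoning

3≤size-shape : ∀ t → 3 ≤ size (shape t)
3≤size-shape B       = s≤s (s≤s (s≤s z≤n))
3≤size-shape (s · t) = ≤-trans (3≤size-shape t) (size≤size-⊛ (shape s) (shape t))

nf : (T : Tree) → App (size T)
nf (node F) = Eval.run _∙_ (v zero) (node F) (map v (allFin _))

nf-leaves : ∀ T → leaves (nf T) ≡ allFin (size T)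
nf-leaves (node F) = begin
    leaves (nf (node F))
  ≡⟨ run-hom leaves (λ _ _ → refl) refl (node F) (map v ks) ⟩
    Eval.run _++_ (zero ∷ []) (node F) (map leaves (map v ks))
  ≡⟨ cong (Eval.run _++_ (zero ∷ []) (node F)) (map-∘ ks) ⟨
    Eval.run _++_ (zero ∷ []) (node F) (map (_∷ []) ks)
  ≡⟨ run-concat (zero ∷ []) (node F) (map (_∷ []) ks) (≤-reflexive k≡length) ⟩
    concat (map (_∷ []) ks)
  ≡⟨ concat-map-[ ks ] ⟩
    ks
  ∎
  where
  open ≡-Reasoning
  ks : List (Fin (size (node F)))
  ks = allFin (size (node F))
  k≡length : size (node F) ≡ length (map (_∷ []) ks)
  k≡length = sym (trans (length-map _ ks) (length-tabulate id))

nf-ordered : ∀ T → Ordered (nf T)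
nf-ordered T = sortedLeaves⇒Ordered (nf T) (≡.subst (AllPairs _<ꟳ_) (sym (nf-leaves T)) (tabulate⁺-< id))

vars : ∀ k → List (Tm k)
vars k = tabulate (λ i → var (opposite i))

tabulate-∷ʳ : ∀ {A : Set} {n} (f : Fin (suc n) → A) →
              tabulate f ≡ tabulate (f ∘ inject₁) ∷ʳ f (fromℕ n)
tabulate-∷ʳ {n = zero}  f = refl
tabulate-∷ʳ {n = suc n} f = cong (f zero ∷_) (tabulate-∷ʳ (f ∘ suc))

opposite-inject₁ : ∀ {n} (i : Fin n) → opposite (inject₁ i) ≡ suc (opposite i)
opposite-inject₁ zero    = refl
opposite-inject₁ (suc i) = cong inject₁ (opposite-inject₁ i)

opposite-fromℕ : ∀ n → opposite (fromℕ n) ≡ zero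
opposite-fromℕ zero    = refl
opposite-fromℕ (suc n) = cong inject₁ (opposite-fromℕ n)

vars-suc : ∀ k → vars (suc k) ≡ map (rename suc) (vars k) ∷ʳ var zero
vars-suc k =
  trans (tabulate-∷ʳ (λ i → var (opposite i))) (cong₂ _∷ʳ_ weakened (cong var (opposite-fromℕ k)))
  where
  weakened : tabulate (λ i → var (opposite (inject₁ i))) ≡ map (rename suc) (vars k)
  weakened = trans (tabulate-cong (cong var ∘ opposite-inject₁))
                   (sym (map-tabulate (λ i → var (opposite i)) (rename suc)))

foldl-⟦⟧ⁿ-vars-suc : ∀ t k → foldl app ⟦ t ⟧ⁿ (vars (suc k)) ≡
                     app (rename suc (foldl app ⟦ t ⟧ⁿ (vars k))) (var zero)
foldl-⟦⟧ⁿ-vars-suc t k = begin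
    foldl app ⟦ t ⟧ⁿ (vars (suc k))
  ≡⟨ cong (foldl app ⟦ t ⟧ⁿ) (vars-suc k) ⟩
    foldl app ⟦ t ⟧ⁿ (map (rename suc) (vars k) ∷ʳ var zero)
  ≡⟨ foldl-∷ʳ app ⟦ t ⟧ⁿ (var zero) (map (rename suc) (vars k)) ⟩
    app (foldl app ⟦ t ⟧ⁿ (map (rename suc) (vars k))) (var zero)
  ≡⟨ cong (λ u → app (foldl app u (map (rename suc) (vars k))) (var zero)) (rename-⟦⟧ⁿ suc t) ⟨
    app (foldl app (rename suc ⟦ t ⟧ⁿ) (map (rename suc) (vars k))) (var zero)
  ≡⟨ cong (λ u → app u (var zero)) (rename-foldl-app suc ⟦ t ⟧ⁿ (vars k)) ⟨
    app (rename suc (foldl app ⟦ t ⟧ⁿ (vars k))) (var zero)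
  ∎
  where open ≡-Reasoning

η-expand : ∀ t k → ⟦ t ⟧ ≡βη lams k (foldl app ⟦ t ⟧ⁿ (vars k))
η-expand t zero    = ≡⇒≡βη (sym (⟦⟧ⁿ-closed t))
η-expand t (suc k) = begin
    ⟦ t ⟧
  ≈⟨ η-expand t k ⟩
    lams k (foldl app ⟦ t ⟧ⁿ (vars k))
  ≈⟨ lams-cong k (bwd η ◅ ε) ⟩
    lams k (lam (app (rename suc (foldl app ⟦ t ⟧ⁿ (vars k))) (var zero)))
  ≡⟨ cong (lams k ∘ lam) (foldl-⟦⟧ⁿ-vars-suc t k) ⟨
    lams (suc k) (foldl app ⟦ t ⟧ⁿ (vars (suc k)))
  ∎
  where open ≡βη-Reasoning

HasShape-nf : ∀ {S : ∀ {n} → Tm n} T → HasShape S T → foldl app S (vars (size T)) ≡βη embed (nf T)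
HasShape-nf {S} (node F) hasShape-S = begin
    foldl app S (vars k)
  ≈⟨ hasShape-S d (vars k) (≤-reflexive (sym (length-tabulate (λ i → var (opposite i))))) ⟩
    Eval.run app d (node F) (vars k)
  ≡⟨ cong (Eval.run app d (node F)) (trans (sym (map-tabulate id (embed ∘ v))) (map-∘ (allFin k))) ⟩
    Eval.run app d (node F) (map embed (map v (allFin k)))
  ≡⟨ run-hom embed (λ _ _ → refl) refl (node F) (map v (allFin k)) ⟨
    embed (nf (node F))
  ∎
  where
  open ≡βη-Reasoning
  k : ℕ
  k = size (node F)
  d : Tm k
  d = embed (v zero)

lemma2p6 : (t : BTm) →
    Σ ℕ λ k → 2 < k × Σ (App k) λ M → Ordered M × (⟦ t ⟧ ≡βη lams k (embed M))
lemma2p6 t = k , 3≤size-shape t , nf (shape t) , nf-ordered (shape t) ,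
  EqClosure.transitive _ (η-expand t k) (lams-cong k (HasShape-nf (shape t) (hasShape t)))
  where
  k : ℕ
  k = size (shape t)
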